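{- Let $d\ge1$ and $\mathbf{u}=(u_1,\dots,u_d)\in \binom{\mathbb{N}}{d}$. Then $\mathrm{Inc}(C(\mathbf{u}))=C(\mathbf{u}+\mathbf{1})$, where $\mathbf{u}+\mathbf{1}=(u_1+1,\dots,u_d+1)$.
   Context: $\mathbb{N}=\{1,2,\dots\}$; $\binom{\mathbb{N}}{d}$ is the set of $d$-subsets of $\mathbb{N}$, each written $\mathbf{u}=(u_1,\dots,u_d)$ with $u_1<\dots<u_d$. Squashed order: $\mathbf{u}<\mathbf{v}$ if the largest element of the symmetric difference of $\mathbf{u}$ and $\mathbf{v}$ lies in $\mathbf{v}$. $C(\mathbf{u})=\{\mathbf{v}\in\binom{\mathbb{N}}{d}\mid \mathbf{v}\le\mathbf{u}\}$ in the squashed order. $\mathrm{Inc}_1$ is the set of maps $\pi:\mathbb{N}\to\mathbb{N}$ with $\pi(j)<\pi(j+1)$ and $\pi(j)\le j+1$ for all $j$, acting by $\pi(\mathbf{u})=(\pi(u_1),\dots,\pi(u_d))$; for a family $\mathcal{F}$, $\mathrm{Inc}(\mathcal{F})=\{\pi(\mathbf{u})\mid\mathbf{u}\in\mathcal{F},\pi\in\mathrm{Inc}_1\}$. -}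

module Defs where

open import Data.Nat using (ℕ; zero; suc; _+_; _≤_; _<_)
open import Data.Fin as Fin using (Fin)
open import Data.Vec using (Vec; lookup; map)
open import Data.Vec.Membership.Propositional using (_∈_; _∉_)
open import Data.Product using (Σ; _×_; ∃; ∃-syntax)
open import Data.Sum using (_⊎_)
open import Relation.Binary.PropositionalEquality using (_≡_)
open import Function.Bundles using (_⇔_)

-- A d-subset u of ℕ = {1,2,...}, written increasingly as a vector (u₁,…,u_d):
-- all entries positive and strictly increasing.
IsDSet : (d : ℕ) → Vec ℕ d → Set
IsDSet d u = (∀ (i : Fin d) → 1 ≤ lookup u i)
           × (∀ (i j : Fin d) → i Fin.< j → lookup u i < lookup u j)

-- Squashed order (strict): v <ₛ u iff the largest element of the symmetric
-- difference of v and u lies in u, i.e. there is m ∈ u, m ∉ v, such that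
-- v and u agree on every k > m.
_<ₛ_ : {d : ℕ} → Vec ℕ d → Vec ℕ d → Set
v <ₛ u = ∃[ m ] (m ∈ u × m ∉ v × (∀ k → m < k → (k ∈ v ⇔ k ∈ u)))

_≤ₛ_ : {d : ℕ} → Vec ℕ d → Vec ℕ d → Set
v ≤ₛ u = v ≡ u ⊎ v <ₛ u

InC : (d : ℕ) → Vec ℕ d → Vec ℕ d → Set
InC d u v = IsDSet d v × v ≤ₛ u

-- Represented as ℕ → ℕ; the value at 0 is
-- irrelevant (never used, since d-sets only contain positive integers).
IsInc₁ : (ℕ → ℕ) → Set
IsInc₁ π = (∀ j → 1 ≤ j → 1 ≤ π j)
         × (∀ j → 1 ≤ j → π j < π (suc j))
         × (∀ j → 1 ≤ j → π j ≤ suc j)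

InInc : (d : ℕ) → (Vec ℕ d → Set) → Vec ℕ d → Set
InInc d F w = ∃[ v ] ∃[ π ] (F v × IsInc₁ π × w ≡ map π v)

plusOne : {d : ℕ} → Vec ℕ d → Vec ℕ d
plusOne = map suc

module Submission where

-- The squashed order only sees sets, so we compare d-sets through their
-- decreasing enumerations: for d-sets v, u we show that v ≤ₛ u holds iff
-- reverse v is lexicographically below reverse u (the colex order).  With
-- this translation both inclusions become statements about lexicographic
-- comparison of decreasing vectors.
--
--  ⊆ : an Inc₁-map π is strictly increasing and satisfies π(j) ≤ j + 1, so
--      π(v) ≤colex π(u) ≤colex u + 1 whenever v ≤colex u.
--  ⊇ : given w ≤ u + 1, let a be the least positive integer missing from w,
--      π_a the map skipping a (an Inc₁-map) and ρ_a its left inverse off a.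
--      Then w = π_a(ρ_a(w)), and ρ_a(w) ≤ u: along the common top part of w
--      and u + 1 the map ρ_a subtracts one; at the first difference either
--      ρ_a decreases the entry of w strictly below that of u, or the rest of
--      w is the initial segment {1,…,k}, which is pointwise below every
--      decreasing vector of positive integers of the same length.

open import Defs
open import Data.Nat using (ℕ; zero; suc; pred; _≤_; _<_; z≤n; s≤s; _<?_; _≤?_; _≟_)
open import Data.Nat.Properties
import Data.Fin as Fin
open import Data.Vec using (Vec; []; _∷_; map; reverse; _∷ʳ_)
open import Data.Vec.Properties
  using (reverse-∷; map-reverse; lookup-map; reverse-injective; toList-reverse; map-id)
open import Data.Vec.Membership.Propositional using (_∈_; _∉_)
open import Data.Vec.Membership.Propositional.Properties using (∈-lookup; ∈-toList⁺; ∈-toList⁻)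
open import Data.Vec.Relation.Unary.Any using (here; there; index)
open import Data.Vec.Relation.Unary.Any.Properties using (lookup-index)
open import Data.Vec.Relation.Binary.Pointwise.Inductive as Pointwise using (Pointwise; []; _∷_)
open import Data.Vec.Relation.Binary.Lex.Strict as Lex using (Lex-≤; base; this; next)
open import Data.List.Membership.Propositional using () renaming (_∈_ to _∈ₗ_)
import Data.List.Relation.Unary.Any.Properties as ListAny
open import Data.Product using (_×_; _,_; proj₁; proj₂; ∃-syntax)
open import Data.Sum using (_⊎_; inj₁; inj₂; [_,_]′)
import Data.Sum as Sum
open import Data.Empty using (⊥-elim)
open import Data.Unit using (⊤; tt)
open import Relation.Nullary using (yes; no)
open import Relation.Binary.Definitions using (tri<; tri≈; tri>)
open import Relation.Binary.Structures using (IsEquivalence)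
open import Relation.Binary.PropositionalEquality
open import Function using (_∘_)
open import Function.Bundles using (_⇔_; mk⇔; Equivalence)
open import Function.Construct.Symmetry using (⇔-sym)
open import Function.Construct.Composition using (_⇔-∘_)

open Equivalence

private variable
  n d a b k x y : ℕ

∈-reverse⁺ : (xs : Vec ℕ n) → k ∈ xs → k ∈ reverse xs
∈-reverse⁺ xs k∈xs = ∈-toList⁻
  (subst (_ ∈ₗ_) (sym (toList-reverse xs)) (ListAny.reverse⁺ (∈-toList⁺ k∈xs)))

∈-reverse⁻ : (xs : Vec ℕ n) → k ∈ reverse xs → k ∈ xs
∈-reverse⁻ xs k∈rxs = ∈-toList⁻
  (ListAny.reverse⁻ (subst (_ ∈ₗ_) (toList-reverse xs) (∈-toList⁺ k∈rxs)))

∈-∷ʳ⁻ : (ys : Vec ℕ n) → k ∈ ys ∷ʳ x → k ∈ ys ⊎ k ≡ x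
∈-∷ʳ⁻ []       (here k≡x)  = inj₂ k≡x
∈-∷ʳ⁻ (y ∷ ys) (here k≡y)  = inj₁ (here k≡y)
∈-∷ʳ⁻ (y ∷ ys) (there k∈) = Sum.map₁ there (∈-∷ʳ⁻ ys k∈)

∈-tail : {v : Vec ℕ n} → k ∈ x ∷ v → k ≢ x → k ∈ v
∈-tail (here k≡x) k≢x = ⊥-elim (k≢x k≡x)
∈-tail (there k∈v) _  = k∈v

_≐_ : Vec ℕ n → Vec ℕ n → Set
v ≐ v′ = ∀ {k} → k ∈ v ⇔ k ∈ v′

reverse-≐ : (v : Vec ℕ n) → v ≐ reverse v
reverse-≐ v = mk⇔ (∈-reverse⁺ v) (∈-reverse⁻ v)

<ₛ-cong : {v v′ u u′ : Vec ℕ n} → v ≐ v′ → u ≐ u′ → v <ₛ u → v′ <ₛ u′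
<ₛ-cong v≐ u≐ (m , m∈u , m∉v , agree) =
  m , to u≐ m∈u , m∉v ∘ from v≐ , λ k m<k → u≐ ⇔-∘ (agree k m<k ⇔-∘ ⇔-sym v≐)

≤ₛ-reverse : {v u : Vec ℕ n} → v ≤ₛ u ⇔ reverse v ≤ₛ reverse u
≤ₛ-reverse {v = v} {u} = mk⇔
  (Sum.map (cong reverse) (<ₛ-cong (reverse-≐ v) (reverse-≐ u)))
  (Sum.map reverse-injective (<ₛ-cong (⇔-sym (reverse-≐ v)) (⇔-sym (reverse-≐ u))))

Descending : Vec ℕ n → Set
Descending []       = ⊤
Descending (x ∷ xs) = (∀ {k} → k ∈ xs → k < x) × Descending xs

Positive : Vec ℕ n → Set
Positive v = ∀ {k} → k ∈ v → 1 ≤ k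

head-max : {v : Vec ℕ n} → Descending (x ∷ v) → k ∈ x ∷ v → k ≤ x
head-max _         (here refl)  = ≤-refl
head-max (x>v , _) (there k∈v) = <⇒≤ (x>v k∈v)

descending-∷ʳ : (ys : Vec ℕ n) → Descending ys → (∀ {k} → k ∈ ys → x < k) →
                Descending (ys ∷ʳ x)
descending-∷ʳ []       _           _    = (λ ()) , tt
descending-∷ʳ (y ∷ ys) (y>ys , dys) x<ys =
  (λ k∈ → [ y>ys , (λ k≡x → subst (_< y) (sym k≡x) (x<ys (here refl))) ]′ (∈-∷ʳ⁻ ys k∈))
  , descending-∷ʳ ys dys (x<ys ∘ there)

dset-tail : {xs : Vec ℕ d} → IsDSet (suc d) (x ∷ xs) → IsDSet d xs
dset-tail (pos , incr) = pos ∘ Fin.suc , λ i j i<j → incr (Fin.suc i) (Fin.suc j) (s≤s i<j)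

dset-head-least : {xs : Vec ℕ d} → IsDSet (suc d) (x ∷ xs) → k ∈ xs → x < k
dset-head-least (_ , incr) k∈xs =
  subst (_ <_) (sym (lookup-index k∈xs)) (incr Fin.zero (Fin.suc (index k∈xs)) (s≤s z≤n))

dset-positive : {w : Vec ℕ d} → IsDSet d w → Positive w
dset-positive (pos , _) k∈w = subst (1 ≤_) (sym (lookup-index k∈w)) (pos (index k∈w))

dset-reverse-descending : (w : Vec ℕ d) → IsDSet d w → Descending (reverse w)
dset-reverse-descending []       _ = tt
dset-reverse-descending (x ∷ xs) D rewrite reverse-∷ x xs =
  descending-∷ʳ (reverse xs) (dset-reverse-descending xs (dset-tail D))
    (dset-head-least D ∘ ∈-reverse⁻ xs)

dset-reverse-positive : (w : Vec ℕ d) → IsDSet d w → Positive (reverse w)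
dset-reverse-positive w D = dset-positive D ∘ ∈-reverse⁻ w

dset-map : (f : ℕ → ℕ) (w : Vec ℕ d) → IsDSet d w →
           (∀ {x} → x ∈ w → 1 ≤ f x) →
           (∀ {x y} → x ∈ w → y ∈ w → x < y → f x < f y) → IsDSet d (map f w)
dset-map f w (_ , incr) f-pos f-mono =
  (λ i → subst (1 ≤_) (sym (lookup-map i f w)) (f-pos (∈-lookup i w))) ,
  (λ i j i<j → subst₂ _<_ (sym (lookup-map i f w)) (sym (lookup-map j f w))
                 (f-mono (∈-lookup i w) (∈-lookup j w) (incr i j i<j)))

plusOne-dset : (u : Vec ℕ d) → IsDSet d u → IsDSet d (plusOne u)
plusOne-dset u D = dset-map suc u D (λ _ → s≤s z≤n) (λ _ _ → s≤s)

_≼_ : Vec ℕ n → Vec ℕ n → Set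
v ≼ u = Lex-≤ _≡_ _<_ v u

≼-refl : {v : Vec ℕ n} → v ≼ v
≼-refl = Lex.≤-refl (Pointwise.refl refl)

≼-trans : {v u w : Vec ℕ n} → v ≼ u → u ≼ w → v ≼ w
≼-trans = Lex.≤-trans (IsEquivalence.isPartialEquivalence isEquivalence) <-resp₂-≡ <-trans

pointwise⇒≼ : {v u : Vec ℕ n} → Pointwise _≤_ v u → v ≼ u
pointwise⇒≼ []          = base tt
pointwise⇒≼ (x≤y ∷ v≤u) with m≤n⇒m<n∨m≡n x≤y
... | inj₁ x<y  = this x<y refl
... | inj₂ refl = next refl (pointwise⇒≼ v≤u)

pointwise-map : (f g : ℕ → ℕ) (v : Vec ℕ n) → (∀ {x} → x ∈ v → f x ≤ g x) →
                Pointwise _≤_ (map f v) (map g v)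
pointwise-map f g []      _   = []
pointwise-map f g (x ∷ v) f≤g = f≤g (here refl) ∷ pointwise-map f g v (f≤g ∘ there)

map-≼ : {f : ℕ → ℕ} → (∀ {x y} → 1 ≤ x → x < y → f x < f y) →
        {v u : Vec ℕ n} → Positive v → v ≼ u → map f v ≼ map f u
map-≼ mono pv (base t)        = base t
map-≼ mono pv (this x<y _)    = this (mono (pv (here refl)) x<y) refl
map-≼ mono pv (next refl v≼u) = next refl (map-≼ mono (pv ∘ there) v≼u)

<ₛ-head-≤ : {v u : Vec ℕ n} → Descending (b ∷ u) → (a ∷ v) <ₛ (b ∷ u) → a ≤ b
<ₛ-head-≤ {a = a} du (m , m∈u , _ , agree) with m <? a
... | yes m<a = head-max du (to (agree a m<a) (here refl))
... | no  m≮a = ≤-trans (≮⇒≥ m≮a) (head-max du m∈u)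

<ₛ-by-head : {v u : Vec ℕ n} → Descending (a ∷ v) → Descending (b ∷ u) → a < b →
             (a ∷ v) <ₛ (b ∷ u)
<ₛ-by-head dv du a<b =
  _ , here refl , (λ b∈v → <⇒≱ a<b (head-max dv b∈v)) ,
  λ k b<k → mk⇔ (λ k∈v → ⊥-elim (<⇒≱ (<-trans a<b b<k) (head-max dv k∈v)))
                (λ k∈u → ⊥-elim (<⇒≱ b<k (head-max du k∈u)))

<ₛ-drop-head : {v u : Vec ℕ n} → Descending (a ∷ v) → Descending (a ∷ u) →
               (a ∷ v) <ₛ (a ∷ u) → v <ₛ u
<ₛ-drop-head (a>v , _) (a>u , _) (m , m∈u , m∉v , agree) =
  m , ∈-tail m∈u (m∉v ∘ here) , m∉v ∘ there ,
  λ k m<k → mk⇔ (λ k∈v → ∈-tail (to   (agree k m<k) (there k∈v)) (<⇒≢ (a>v k∈v)))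
                (λ k∈u → ∈-tail (from (agree k m<k) (there k∈u)) (<⇒≢ (a>u k∈u)))

<ₛ-add-head : {v u : Vec ℕ n} → Descending (a ∷ u) → v <ₛ u → (a ∷ v) <ₛ (a ∷ u)
<ₛ-add-head (a>u , _) (m , m∈u , m∉v , agree) =
  m , there m∈u , (λ { (here m≡a) → <⇒≢ (a>u m∈u) m≡a ; (there m∈v) → m∉v m∈v }) ,
  λ k m<k → mk⇔ (λ { (here k≡a) → here k≡a ; (there k∈v) → there (to   (agree k m<k) k∈v) })
                (λ { (here k≡a) → here k≡a ; (there k∈u) → there (from (agree k m<k) k∈u) })

squashed⇒colex : (v u : Vec ℕ n) → Descending v → Descending u → v ≤ₛ u → v ≼ u
squashed⇒colex v .v _ _ (inj₁ refl) = ≼-refl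
squashed⇒colex [] [] _ _ (inj₂ _) = base tt
squashed⇒colex (a ∷ v) (b ∷ u) dv du (inj₂ lt) with m≤n⇒m<n∨m≡n (<ₛ-head-≤ du lt)
... | inj₁ a<b  = this a<b refl
... | inj₂ refl =
  next refl (squashed⇒colex v u (proj₂ dv) (proj₂ du) (inj₂ (<ₛ-drop-head dv du lt)))

colex⇒squashed : (v u : Vec ℕ n) → Descending v → Descending u → v ≼ u → v ≤ₛ u
colex⇒squashed [] [] _ _ _ = inj₁ refl
colex⇒squashed (a ∷ v) (b ∷ u) dv du (this a<b _) = inj₂ (<ₛ-by-head dv du a<b)
colex⇒squashed (a ∷ v) (b ∷ u) dv du (next refl v≼u)
  with colex⇒squashed v u (proj₂ dv) (proj₂ du) v≼u
... | inj₁ refl = inj₁ refl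
... | inj₂ v<u  = inj₂ (<ₛ-add-head du v<u)

dset-≤ₛ⇔≼ : (v u : Vec ℕ d) → IsDSet d v → IsDSet d u → v ≤ₛ u ⇔ reverse v ≼ reverse u
dset-≤ₛ⇔≼ v u vD uD =
  mk⇔ (squashed⇒colex _ _ dv du) (colex⇒squashed _ _ dv du) ⇔-∘ ≤ₛ-reverse
  where
  dv = dset-reverse-descending v vD
  du = dset-reverse-descending u uD

inc₁-strictMono : {π : ℕ → ℕ} → IsInc₁ π → 1 ≤ x → x < y → π x < π y
inc₁-strictMono {x = x} {suc y} I@(_ , step , _) 1≤x (s≤s x≤y) with m≤n⇒m<n∨m≡n x≤y
... | inj₁ x<y  = <-trans (inc₁-strictMono I 1≤x x<y) (step y (≤-trans 1≤x x≤y))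
... | inj₂ refl = step x 1≤x

inc₁-image-dset : {π : ℕ → ℕ} (v : Vec ℕ d) → IsInc₁ π → IsDSet d v → IsDSet d (map π v)
inc₁-image-dset {π = π} v I@(pos , _ , _) vD =
  dset-map π v vD (λ x∈v → pos _ (dset-positive vD x∈v))
                (λ x∈v _ → inc₁-strictMono I (dset-positive vD x∈v))

-- π(v) ≼ π(u) ≼ u + 1 on decreasing enumerations, since π(j) ≤ j + 1.
inc₁-image-≼ : {π : ℕ → ℕ} (v u : Vec ℕ d) → IsInc₁ π → IsDSet d v → IsDSet d u →
               reverse v ≼ reverse u → reverse (map π v) ≼ reverse (plusOne u)
inc₁-image-≼ {π = π} v u I@(_ , _ , bound) vD uD v≼u =
  subst₂ _≼_ (map-reverse π v) (map-reverse suc u)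
    (≼-trans (map-≼ (inc₁-strictMono I) (dset-reverse-positive v vD) v≼u)
             (pointwise⇒≼ (pointwise-map π suc (reverse u)
                             (bound _ ∘ dset-reverse-positive u uD))))

inc-image⊆C : (u : Vec ℕ d) {w : Vec ℕ d} → IsDSet d u → InInc d (InC d u) w →
              InC d (plusOne u) w
inc-image⊆C u uD (v , π , (vD , v≤u) , I , refl) =
  πvD , from (dset-≤ₛ⇔≼ (map π v) (plusOne u) πvD (plusOne-dset u uD))
             (inc₁-image-≼ v u I vD uD (to (dset-≤ₛ⇔≼ v u vD uD) v≤u))
  where πvD = inc₁-image-dset v I vD

skip : ℕ → ℕ → ℕ
skip a j with j <? a
... | yes _ = j
... | no  _ = suc j

unskip : ℕ → ℕ → ℕ
unskip a j with j ≤? a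
... | yes _ = j
... | no  _ = pred j

skip-below : x < a → skip a x ≡ x
skip-below {x} {a} x<a with x <? a
... | yes _   = refl
... | no  x≮a = ⊥-elim (x≮a x<a)

skip-above : a ≤ x → skip a x ≡ suc x
skip-above {a} {x} a≤x with x <? a
... | yes x<a = ⊥-elim (<⇒≱ x<a a≤x)
... | no  _   = refl

skip-≥ : ∀ a x → x ≤ skip a x
skip-≥ a x with x <? a
... | yes _ = ≤-refl
... | no  _ = n≤1+n x

skip-≤ : ∀ a x → skip a x ≤ suc x
skip-≤ a x with x <? a
... | yes _ = n≤1+n x
... | no  _ = ≤-refl

skip-inc₁ : ∀ a → IsInc₁ (skip a)
skip-inc₁ a = (λ x 1≤x → ≤-trans 1≤x (skip-≥ a x)) , step , (λ x _ → skip-≤ a x)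
  where
  step : ∀ x → 1 ≤ x → skip a x < skip a (suc x)
  step x _ with x <? a
  ... | yes _   = skip-≥ a (suc x)
  ... | no  x≮a rewrite skip-above (m≤n⇒m≤1+n (≮⇒≥ x≮a)) = ≤-refl

unskip-upTo : x ≤ a → unskip a x ≡ x
unskip-upTo {x} {a} x≤a with x ≤? a
... | yes _   = refl
... | no  x≰a = ⊥-elim (x≰a x≤a)

unskip-above : a < x → unskip a x ≡ pred x
unskip-above {a} {x} a<x with x ≤? a
... | yes x≤a = ⊥-elim (<⇒≱ a<x x≤a)
... | no  _   = refl

unskip-≤ : ∀ a x → unskip a x ≤ x
unskip-≤ a x with x ≤? a
... | yes _ = ≤-refl
... | no  _ = pred[n]≤n

skip∘unskip : x ≢ a → skip a (unskip a x) ≡ x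
skip∘unskip {x} {a} x≢a with <-cmp x a
... | tri< x<a _ _ rewrite unskip-upTo (<⇒≤ x<a) = skip-below x<a
... | tri≈ _ x≡a _ = ⊥-elim (x≢a x≡a)
skip∘unskip {suc x} {a} _ | tri> _ _ a<x rewrite unskip-above a<x =
  skip-above (≤-pred a<x)

map-skip∘unskip : ∀ a (w : Vec ℕ n) → a ∉ w → map (skip a) (map (unskip a) w) ≡ w
map-skip∘unskip a []      _   = refl
map-skip∘unskip a (x ∷ w) a∉w =
  cong₂ _∷_ (skip∘unskip (a∉w ∘ here ∘ sym)) (map-skip∘unskip a w (a∉w ∘ there))

unskip-positive : 1 ≤ a → 1 ≤ x → x ≢ a → 1 ≤ unskip a x
unskip-positive {a} {x} 1≤a 1≤x x≢a with <-cmp x a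
... | tri< x<a _ _ rewrite unskip-upTo (<⇒≤ x<a) = 1≤x
... | tri≈ _ x≡a _ = ⊥-elim (x≢a x≡a)
unskip-positive {a} {suc x} 1≤a _ _ | tri> _ _ a<x rewrite unskip-above a<x =
  ≤-trans 1≤a (≤-pred a<x)

unskip-strictMono : x ≢ a → y ≢ a → x < y → unskip a x < unskip a y
unskip-strictMono {x} {a} {y} x≢a y≢a x<y with <-cmp y a
... | tri< y<a _ _ rewrite unskip-upTo (<⇒≤ y<a) | unskip-upTo (<⇒≤ (<-trans x<y y<a)) =
  x<y
... | tri≈ _ y≡a _ = ⊥-elim (y≢a y≡a)
unskip-strictMono {x} {a} {suc y} x≢a _ x<y | tri> _ _ a<y with <-cmp x a
... | tri< x<a _ _ rewrite unskip-upTo (<⇒≤ x<a) | unskip-above a<y =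
  ≤-trans x<a (≤-pred a<y)
... | tri≈ _ x≡a _ = ⊥-elim (x≢a x≡a)
unskip-strictMono {suc x} {a} {suc y} _ _ x<y | tri> _ _ a<y | tri> _ _ a<x
  rewrite unskip-above a<x | unskip-above a<y = ≤-pred x<y

ContainsBelow : ℕ → Vec ℕ n → Set
ContainsBelow b v = ∀ j → 1 ≤ j → j < b → j ∈ v

containsBelow-tail : {v : Vec ℕ n} → ContainsBelow b (x ∷ v) → a ≤ b → a ≤ x →
                     ContainsBelow a v
containsBelow-tail below a≤b a≤x j 1≤j j<a =
  ∈-tail (below j 1≤j (<-≤-trans j<a a≤b)) (<⇒≢ (<-≤-trans j<a a≤x))

containsBelow-bound : (v : Vec ℕ n) → Descending v → ContainsBelow b v → b ≤ suc n
containsBelow-bound {b = b} [] _ below with 1 <? b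
... | no  1≮b = ≮⇒≥ 1≮b
... | yes 1<b with below 1 ≤-refl 1<b
...   | ()
containsBelow-bound {b = b} (x ∷ v) dv below with b ≤? x
... | yes b≤x =
  m≤n⇒m≤1+n (containsBelow-bound v (proj₂ dv) (containsBelow-tail below ≤-refl b≤x))
... | no  b≰x =
  ≤-trans b≤1+x (s≤s (containsBelow-bound v (proj₂ dv) (containsBelow-tail below (<⇒≤ x<b) ≤-refl)))
  where
  x<b : x < b
  x<b = ≰⇒> b≰x
  b≤1+x : b ≤ suc x
  b≤1+x with suc x <? b
  ... | yes 1+x<b = ⊥-elim (1+n≰n (head-max dv (below (suc x) (s≤s z≤n) 1+x<b)))
  ... | no  1+x≮b = ≮⇒≥ 1+x≮b

length≤head : (u : Vec ℕ n) → Descending (y ∷ u) → Positive (y ∷ u) → suc n ≤ y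
length≤head []       _          pu = pu (here refl)
length≤head (z ∷ u) (y>u , du) pu =
  ≤-trans (s≤s (length≤head u du (pu ∘ there))) (y>u (here refl))

initialSegment-least : (v u : Vec ℕ n) → Descending v → (∀ {k} → k ∈ v → k < b) →
                       ContainsBelow b v → Descending u → Positive u → Pointwise _≤_ v u
initialSegment-least [] [] _ _ _ _ _ = []
initialSegment-least {b = b} (x ∷ v) (y ∷ u) dv v<b below du pu =
  ≤-trans (≤-pred (≤-trans x<b (containsBelow-bound (x ∷ v) dv below)))
          (length≤head u du pu)
  ∷ initialSegment-least v u (proj₂ dv) (proj₁ dv)
      (containsBelow-tail below (<⇒≤ x<b) ≤-refl) (proj₂ du) (pu ∘ there)
  where
  x<b : x < b
  x<b = v<b (here refl)

leastMissing : (w : Vec ℕ n) → Descending w →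
               ∃[ a ] (1 ≤ a × a ∉ w × ContainsBelow a w)
leastMissing [] _ = 1 , ≤-refl , (λ ()) , λ j 1≤j j<1 → ⊥-elim (<⇒≱ j<1 1≤j)
leastMissing (x ∷ w) (x>w , dw) with leastMissing w dw
... | a , 1≤a , a∉w , below with a ≟ x
...   | yes refl = suc a , s≤s z≤n ,
          (λ { (here a+1≡a)  → 1+n≰n (≤-reflexive a+1≡a)
             ; (there a+1∈w) → 1+n≰n (<⇒≤ (x>w a+1∈w)) }) ,
          λ j 1≤j j<a+1 → [ there ∘ below j 1≤j , here ]′ (m≤n⇒m<n∨m≡n (≤-pred j<a+1))
...   | no  a≢x = a , 1≤a , (λ { (here a≡x) → a≢x a≡x ; (there a∈w) → a∉w a∈w }) ,
          λ j 1≤j j<a → there (below j 1≤j j<a)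

unskip-≼ : ∀ a (w u : Vec ℕ n) → Descending w → a ∉ w → ContainsBelow a w →
           Descending u → Positive u → w ≼ map suc u → map (unskip a) w ≼ u
unskip-≼ a [] [] _ _ _ _ _ _ = base tt
unskip-≼ a (x ∷ w) (y ∷ u) dw a∉w below du pu w≼u+1 with <-cmp x a
... | tri< x<a _ _ = pointwise⇒≼ (Pointwise.trans ≤-trans unskip-w≤w w≤u)
  where
  unskip-w≤w : Pointwise _≤_ (map (unskip a) (x ∷ w)) (x ∷ w)
  unskip-w≤w = subst (Pointwise _≤_ _) (map-id (x ∷ w))
                     (pointwise-map (unskip a) _ (x ∷ w) λ {z} _ → unskip-≤ a z)
  -- all entries are below a, so x ∷ w is the initial segment {1,…,a−1}
  w≤u : Pointwise _≤_ (x ∷ w) (y ∷ u)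
  w≤u = initialSegment-least (x ∷ w) (y ∷ u) dw (λ k∈ → ≤-<-trans (head-max dw k∈) x<a)
                             below du pu
... | tri≈ _ x≡a _ = ⊥-elim (a∉w (here (sym x≡a)))
unskip-≼ a (zero ∷ w) (y ∷ u) _ _ _ _ _ _ | tri> _ _ ()
unskip-≼ a (suc x ∷ w) (y ∷ u) dw a∉w below du pu w≼u+1 | tri> _ _ a<x
  rewrite unskip-above a<x with w≼u+1
... | this x<y _        = this (≤-pred x<y) refl
... | next refl w≼u+1′  = next refl
        (unskip-≼ a w u (proj₂ dw) (a∉w ∘ there) (containsBelow-tail below ≤-refl (<⇒≤ a<x))
                  (proj₂ du) (pu ∘ there) w≼u+1′)

unskip-∈C : {u w : Vec ℕ d} → IsDSet d u → InC d (plusOne u) w →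
            1 ≤ a → a ∉ w → ContainsBelow a (reverse w) → InC d u (map (unskip a) w)
unskip-∈C {a = a} {u} {w} uD (wD , w≤u+1) 1≤a a∉w below =
  vD , from (dset-≤ₛ⇔≼ (map (unskip a) w) u vD uD) v≼u
  where
  x≢a : ∀ {x} → x ∈ w → x ≢ a
  x≢a x∈w refl = a∉w x∈w
  vD : IsDSet _ (map (unskip a) w)
  vD = dset-map (unskip a) w wD
         (λ x∈w → unskip-positive 1≤a (dset-positive wD x∈w) (x≢a x∈w))
         (λ x∈w y∈w → unskip-strictMono (x≢a x∈w) (x≢a y∈w))
  w≼u+1 : reverse w ≼ map suc (reverse u)
  w≼u+1 = subst (reverse w ≼_) (sym (map-reverse suc u))
                (to (dset-≤ₛ⇔≼ w (plusOne u) wD (plusOne-dset u uD)) w≤u+1)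
  v≼u : reverse (map (unskip a) w) ≼ reverse u
  v≼u = subst (_≼ reverse u) (map-reverse (unskip a) w)
          (unskip-≼ a (reverse w) (reverse u) (dset-reverse-descending w wD)
                    (a∉w ∘ ∈-reverse⁻ w) below
                    (dset-reverse-descending u uD) (dset-reverse-positive u uD) w≼u+1)

C⊆inc-image : {u : Vec ℕ d} → IsDSet d u → (w : Vec ℕ d) → InC d (plusOne u) w →
              InInc d (InC d u) w
C⊆inc-image uD w w∈C with leastMissing (reverse w) (dset-reverse-descending w (proj₁ w∈C))
... | a , 1≤a , a∉rw , below =
  map (unskip a) w , skip a , unskip-∈C uD w∈C 1≤a a∉w below , skip-inc₁ a ,
  sym (map-skip∘unskip a w a∉w)
  where a∉w = a∉rw ∘ ∈-reverse⁺ w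

lemma3p2 : (d : ℕ) → 1 ≤ d → (u : Vec ℕ d) → IsDSet d u →
    (w : Vec ℕ d) → InInc d (InC d u) w ⇔ InC d (plusOne u) w
lemma3p2 d _ u uD w = mk⇔ (inc-image⊆C u uD) (C⊆inc-image uD w)
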